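{- For any integers $d \ge 3$ and $k \ge 1$, $$P(dk+d-1,d) \ge \left((k+1)^d - \binom{k+d-1}{d-1}\right) P(dk-1,d).$$
   Context: A permutation on $\{1,\dots,n\}$ is a sequence listing each element of $\{1,\dots,n\}$ exactly once. The Chebyshev distance between permutations $\sigma,\pi$ is $\max_{i}|\sigma(i)-\pi(i)|$. $P(n,d)$ denotes the maximum cardinality of a set of permutations on $\{1,\dots,n\}$ in which any two distinct permutations have Chebyshev distance at least $d$. -}

module Defs where

open import Data.Nat using (ℕ; zero; suc; _⊔_; _≤_; _≥_; ∣_-_∣)
open import Data.Fin using (Fin; toℕ)
open import Data.Fin.Permutation using (Permutation′; _⟨$⟩ʳ_)
open import Data.List using (List; length)
open import Data.List.Relation.Unary.AllPairs using (AllPairs)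
open import Data.Product using (_×_; Σ)
open import Relation.Binary.PropositionalEquality using (_≡_)

maxFin : ∀ {n} → (Fin n → ℕ) → ℕ
maxFin {zero}  f = 0
maxFin {suc n} f = f Fin.zero ⊔ maxFin {n} (λ i → f (Fin.suc i))

-- Chebyshev distance: max_i |σ(i) - π(i)|  (values taken in {0..n-1}, a shift by 1 is irrelevant)
chebyshev : ∀ {n} → Permutation′ n → Permutation′ n → ℕ
chebyshev σ π = maxFin (λ i → ∣ toℕ (σ ⟨$⟩ʳ i) - toℕ (π ⟨$⟩ʳ i) ∣)

IsCode : (n d : ℕ) → List (Permutation′ n) → Set
IsCode n d C = AllPairs (λ σ π → chebyshev σ π ≥ d) C

IsP : (n d m : ℕ) → Set
IsP n d m = Σ (List (Permutation′ n)) (λ C → IsCode n d C × length C ≡ m)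
          × (∀ (C : List (Permutation′ n)) → IsCode n d C → length C ≤ m)

{-# OPTIONS --safe #-}
-- Let n = dk − 1 and N = d + n.  A code on n points is extended by d new leading positions
-- whose images are written in base d: position i + 1 (i < d − 1) gets i + cᵢ·d with a digit
-- cᵢ ∈ {0,…,k}, and position 0 gets s + v·d with v ∈ {0,…,k}, where the low digit s ≤ d − 2
-- (the slot) is nondecreasing in v and avoids a collision with the other d − 1 values unless
-- c is nondecreasing and v is its last entry.  The values stay below N because d·k ≤ n + 1.
-- Two distinct tails (c, v) differ by at least d at some new position; for equal tails the
-- old positions carry σ composed with the order-preserving enumeration of the unused values,
-- which does not shrink distances.  Since there are C(k + d − 1, d − 1) nondecreasing c, every
-- codeword yields (k + 1)^d − C(k + d − 1, d − 1) codewords at mutual distance at least d.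
module Submission where

open import Defs
open import Data.Nat using (ℕ; _+_; _*_; _∸_; _^_; _≤_; _≥_)
open import Data.Nat.Combinatorics using (_C_)

open import Data.Empty using (⊥-elim)
open import Data.Fin as Fin using (Fin; toℕ; fromℕ<; punchIn; punchOut; _↑ˡ_; _↑ʳ_)
open import Data.Fin.Permutation using (Permutation′; _⟨$⟩ʳ_; insert)
open import Data.Fin.Properties
  using (0≢1+n; suc-injective; punchOut-cong; punchOut-injective; punchIn-punchOut;
         toℕ-fromℕ<; toℕ-injective; toℕ<n; ¬∀⟶∃¬)
open import Data.List using (List; []; _∷_; [_]; map; concatMap; filter; length; downFrom)
open import Data.List.Properties
  using (length-++; length-map; length-downFrom; map-concatMap; map-∘; map-cong;
         filter-all)
open import Data.List.Relation.Unary.All as All using (All; []; _∷_)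
import Data.List.Relation.Unary.All.Properties as Allₚ
open import Data.List.Relation.Unary.AllPairs as AllPairs using (AllPairs; []; _∷_)
import Data.List.Relation.Unary.AllPairs.Properties as AllPairsₚ
open import Data.List.Relation.Unary.Unique.Propositional using (Unique)
import Data.List.Relation.Unary.Unique.Propositional.Properties as Uniqueₚ
open import Data.Nat using (zero; suc; _<_; z≤n; s≤s; s≤s⁻¹; ∣_-_∣; NonZero; _≤?_)
open import Data.Nat.DivMod using (_%_; [m+kn]%n≡m%n; m<n⇒m%n≡m)
open import Data.Nat.ListAction using (sum)
open import Data.Nat.ListAction.Properties using (sum-++)
open import Data.Nat.Combinatorics using (nCn≡1; nCk+nC[k+1]≡[n+1]C[k+1])
open import Data.Nat.Properties
  hiding (suc-injective; 0≢1+n)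
import Data.Nat.Properties as ℕₚ
open import Algebra.Properties.CommutativeSemigroup +-commutativeSemigroup
  using (interchange; x∙yz≈y∙xz)
open import Data.Product using (Σ; ∃-syntax; _×_; _,_; proj₁; proj₂)
import Data.Product.Properties as Productₚ
open import Data.Sum using (inj₁; inj₂)
open import Data.Vec using (Vec; []; _∷_; lookup; last; tabulate)
import Data.Vec.Properties as Vecₚ
import Data.Vec.Relation.Unary.All as VecAll
import Data.Vec.Relation.Unary.All.Properties as VecAllₚ
open import Function using (_∘_; id)
open import Function.Definitions using (Injective)
open import Relation.Binary.Definitions using (DecidableEquality; tri<; tri≈; tri>)
open import Relation.Binary.PropositionalEquality hiding ([_])
open import Relation.Nullary using (yes; no; ¬?)

module _ {A : Set} where

  length-concatMap : ∀ {B : Set} (f : A → List B) xs →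
    length (concatMap f xs) ≡ sum (map (length ∘ f) xs)
  length-concatMap f []       = refl
  length-concatMap f (x ∷ xs) =
    trans (length-++ (f x)) (cong (length (f x) +_) (length-concatMap f xs))

  sum-concatMap : ∀ (f : A → List ℕ) xs → sum (concatMap f xs) ≡ sum (map (sum ∘ f) xs)
  sum-concatMap f []       = refl
  sum-concatMap f (x ∷ xs) = trans (sum-++ (f x) _) (cong (sum (f x) +_) (sum-concatMap f xs))

  sum-map-const : ∀ c (xs : List A) → sum (map (λ _ → c) xs) ≡ length xs * c
  sum-map-const c []       = refl
  sum-map-const c (x ∷ xs) = cong (c +_) (sum-map-const c xs)

  sum-map-+ : ∀ (f g : A → ℕ) xs →
    sum (map (λ x → f x + g x) xs) ≡ sum (map f xs) + sum (map g xs)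
  sum-map-+ f g []       = refl
  sum-map-+ f g (x ∷ xs) =
    trans (cong (f x + g x +_) (sum-map-+ f g xs)) (interchange (f x) (g x) _ _)

  sum-map-≥ : ∀ {c} (f : A → ℕ) → (∀ x → c ≤ f x) → ∀ xs → length xs * c ≤ sum (map f xs)
  sum-map-≥ f c≤f []       = z≤n
  sum-map-≥ f c≤f (x ∷ xs) = +-mono-≤ (c≤f x) (sum-map-≥ f c≤f xs)

  map-proj₁-toList : ∀ {P : A → Set} {xs} (pxs : All P xs) → map proj₁ (All.toList pxs) ≡ xs
  map-proj₁-toList []         = refl
  map-proj₁-toList (px ∷ pxs) = cong (_ ∷_) (map-proj₁-toList pxs)

  module _ (_≟_ : DecidableEquality A) where

    length≤suc-length-filter-≢ : ∀ y {xs} → Unique xs →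
      length xs ≤ suc (length (filter (λ x → ¬? (x ≟ y)) xs))
    length≤suc-length-filter-≢ y []               = z≤n
    length≤suc-length-filter-≢ y {x ∷ xs} (x∉xs ∷ xs!) with x ≟ y
    ... | yes refl = s≤s (≤-reflexive (sym (cong length
          (filter-all _ (All.map (λ y≢z z≡y → y≢z (sym z≡y)) x∉xs)))))
    ... | no _     = s≤s (length≤suc-length-filter-≢ y xs!)

length-concatMap-map : ∀ {A B C : Set} (f : A → B → C) (ys : A → List B) xs →
  length (concatMap (λ a → map (f a) (ys a)) xs) ≡ sum (map (length ∘ ys) xs)
length-concatMap-map f ys xs = trans (length-concatMap _ xs)
  (cong sum (map-cong (λ a → length-map (f a) (ys a)) xs))

module _ {A B C : Set} {S : A → A → Set} {T : B → B → Set} {R : C → C → Set}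
         (f : A → B → C) (ys : A → List B) where

  AllPairs-concatMap⁺ :
    (∀ {a b b′} → T b b′ → R (f a b) (f a b′)) →
    (∀ {a a′} → S a a′ → ∀ b b′ → R (f a b) (f a′ b′)) →
    ∀ {xs} → AllPairs S xs → (∀ a → AllPairs T (ys a)) →
    AllPairs R (concatMap (λ a → map (f a) (ys a)) xs)
  AllPairs-concatMap⁺ within across {xs} Sxs Tys = AllPairsₚ.concat⁺
    (Allₚ.map⁺ (All.universal (λ a → AllPairsₚ.map⁺ (AllPairs.map within (Tys a))) xs))
    (AllPairsₚ.map⁺ (AllPairs.map
      (λ s → Allₚ.map⁺ (All.universal (λ b → Allₚ.map⁺ (All.universal (across s b) _)) _)) Sxs))

toℕ≤toℕ-punchIn : ∀ {n} (i : Fin (suc n)) (j : Fin n) → toℕ j ≤ toℕ (punchIn i j)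
toℕ≤toℕ-punchIn Fin.zero    j           = n≤1+n _
toℕ≤toℕ-punchIn (Fin.suc i) Fin.zero    = z≤n
toℕ≤toℕ-punchIn (Fin.suc i) (Fin.suc j) = s≤s (toℕ≤toℕ-punchIn i j)

punchIn-expanding : ∀ {n} (i : Fin (suc n)) (j j′ : Fin n) →
  ∣ toℕ j - toℕ j′ ∣ ≤ ∣ toℕ (punchIn i j) - toℕ (punchIn i j′) ∣
punchIn-expanding Fin.zero    j           j′          = ≤-refl
punchIn-expanding (Fin.suc i) Fin.zero    Fin.zero    = ≤-refl
punchIn-expanding (Fin.suc i) Fin.zero    (Fin.suc j′) = s≤s (toℕ≤toℕ-punchIn i j′)
punchIn-expanding (Fin.suc i) (Fin.suc j) Fin.zero    = s≤s (toℕ≤toℕ-punchIn i j)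
punchIn-expanding (Fin.suc i) (Fin.suc j) (Fin.suc j′) = punchIn-expanding i j j′

≤-maxFin : ∀ {n} (f : Fin n → ℕ) i → f i ≤ maxFin f
≤-maxFin f Fin.zero    = m≤m⊔n _ _
≤-maxFin f (Fin.suc i) = ≤-trans (≤-maxFin (f ∘ Fin.suc) i) (m≤n⊔m _ _)

maxFin-witness : ∀ {n} (f : Fin n → ℕ) {t} → t < maxFin f → ∃[ i ] t < f i
maxFin-witness {suc n} f {t} t<max with ⊔-sel (f Fin.zero) (maxFin (f ∘ Fin.suc))
... | inj₁ eq = Fin.zero , subst (t <_) eq t<max
... | inj₂ eq with maxFin-witness (f ∘ Fin.suc) (subst (t <_) eq t<max)
...   | i , t<fi = Fin.suc i , t<fi

≤-chebyshev : ∀ {n} (σ π : Permutation′ n) i →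
  ∣ toℕ (σ ⟨$⟩ʳ i) - toℕ (π ⟨$⟩ʳ i) ∣ ≤ chebyshev σ π
≤-chebyshev σ π = ≤-maxFin _

chebyshev-witness : ∀ {n} (σ π : Permutation′ n) {t} → t < chebyshev σ π →
  ∃[ i ] t < ∣ toℕ (σ ⟨$⟩ʳ i) - toℕ (π ⟨$⟩ʳ i) ∣
chebyshev-witness σ π = maxFin-witness _

-- Extending permutations

punchOut-cong₂ : ∀ {m} {i i′ j j′ : Fin (suc m)} (i≢j : i ≢ j) (i′≢j′ : i′ ≢ j′) →
  i ≡ i′ → j ≡ j′ → punchOut i≢j ≡ punchOut i′≢j′
punchOut-cong₂ {i = i} _ _ refl refl = punchOut-cong i refl

head≢tail : ∀ {d m} (g : Fin (suc d) → Fin (suc m)) → Injective _≡_ _≡_ g →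
  ∀ j → g Fin.zero ≢ g (Fin.suc j)
head≢tail g inj j = 0≢1+n ∘ inj

punchOutHead : ∀ {d m} (g : Fin (suc d) → Fin (suc m)) → Injective _≡_ _≡_ g → Fin d → Fin m
punchOutHead g inj j = punchOut (head≢tail g inj j)

punchOutHead-injective : ∀ {d m} (g : Fin (suc d) → Fin (suc m)) (inj : Injective _≡_ _≡_ g) →
  Injective _≡_ _≡_ (punchOutHead g inj)
punchOutHead-injective g inj eq =
  suc-injective (inj (punchOut-injective (head≢tail g inj _) (head≢tail g inj _) eq))

-- The order-preserving enumeration of the values missed by g.
coreEmbedding : ∀ {d n} (g : Fin d → Fin (d + n)) → Injective _≡_ _≡_ g → Fin n → Fin (d + n)
coreEmbedding {zero}  g inj = id
coreEmbedding {suc d} g inj =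
  punchIn (g Fin.zero) ∘ coreEmbedding (punchOutHead g inj) (punchOutHead-injective g inj)

extend : ∀ {d n} (g : Fin d → Fin (d + n)) → Injective _≡_ _≡_ g →
  Permutation′ n → Permutation′ (d + n)
extend {zero}  g inj σ = σ
extend {suc d} g inj σ =
  insert Fin.zero (g Fin.zero) (extend (punchOutHead g inj) (punchOutHead-injective g inj) σ)

extend-↑ˡ : ∀ {d n} (g : Fin d → Fin (d + n)) (inj : Injective _≡_ _≡_ g) σ j →
  extend g inj σ ⟨$⟩ʳ (j ↑ˡ n) ≡ g j
extend-↑ˡ {suc d} g inj σ Fin.zero    = refl
extend-↑ˡ {suc d} g inj σ (Fin.suc j) =
  trans (cong (punchIn (g Fin.zero))
           (extend-↑ˡ (punchOutHead g inj) (punchOutHead-injective g inj) σ j))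
        (punchIn-punchOut _)

extend-↑ʳ : ∀ {d n} (g : Fin d → Fin (d + n)) (inj : Injective _≡_ _≡_ g) σ u →
  extend g inj σ ⟨$⟩ʳ (d ↑ʳ u) ≡ coreEmbedding g inj (σ ⟨$⟩ʳ u)
extend-↑ʳ {zero}  g inj σ u = refl
extend-↑ʳ {suc d} g inj σ u =
  cong (punchIn (g Fin.zero)) (extend-↑ʳ (punchOutHead g inj) (punchOutHead-injective g inj) σ u)

coreEmbedding-cong : ∀ {d n} {g g′ : Fin d → Fin (d + n)}
  (inj : Injective _≡_ _≡_ g) (inj′ : Injective _≡_ _≡_ g′) →
  g ≗ g′ → coreEmbedding g inj ≗ coreEmbedding g′ inj′
coreEmbedding-cong {zero}  inj inj′ g≗g′ u = refl
coreEmbedding-cong {suc d} {g = g} {g′} inj inj′ g≗g′ u =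
  cong₂ punchIn (g≗g′ Fin.zero)
    (coreEmbedding-cong (punchOutHead-injective g inj) (punchOutHead-injective g′ inj′)
      (λ j → punchOut-cong₂ _ _ (g≗g′ Fin.zero) (g≗g′ (Fin.suc j))) u)

coreEmbedding-expanding : ∀ {d n} (g : Fin d → Fin (d + n)) (inj : Injective _≡_ _≡_ g) u w →
  ∣ toℕ u - toℕ w ∣ ≤ ∣ toℕ (coreEmbedding g inj u) - toℕ (coreEmbedding g inj w) ∣
coreEmbedding-expanding {zero}  g inj u w = ≤-refl
coreEmbedding-expanding {suc d} g inj u w =
  ≤-trans (coreEmbedding-expanding (punchOutHead g inj) (punchOutHead-injective g inj) u w)
    (punchIn-expanding (g Fin.zero) _ _)

-- Ascending vectors

-- An indicator rather than a predicate, so that ascending vectors can be counted by summation.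
ascending : ∀ {j} → ℕ → Vec ℕ j → ℕ
ascending lo []       = 1
ascending lo (x ∷ xs) with lo ≤? x
... | yes _ = ascending x xs
... | no  _ = 0

ascending-∷-≤ : ∀ {j lo x} (xs : Vec ℕ j) → lo ≤ x → ascending lo (x ∷ xs) ≡ ascending x xs
ascending-∷-≤ {lo = lo} {x} xs lo≤x with lo ≤? x
... | yes _    = refl
... | no lo≰x = ⊥-elim (lo≰x lo≤x)

ascending-∷-> : ∀ {j lo x} (xs : Vec ℕ j) → x < lo → ascending lo (x ∷ xs) ≡ 0
ascending-∷-> {lo = lo} {x} xs x<lo with lo ≤? x
... | yes lo≤x = ⊥-elim (<⇒≱ x<lo lo≤x)
... | no  _    = refl

-- The length of the longest prefix x₀ ≤ ⋯ ≤ xₛ₋₁ ≤ v with lo ≤ x₀, capped at the last index.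
slot : ∀ {j} → ℕ → Vec ℕ (suc j) → ℕ → ℕ
slot lo (x ∷ [])     v = 0
slot lo (x ∷ y ∷ ys) v with lo ≤? x | x ≤? v
... | yes _ | yes _ = suc (slot x (y ∷ ys) v)
... | _     | _     = 0

slot-≤ : ∀ {j} lo (c : Vec ℕ (suc j)) v → slot lo c v ≤ j
slot-≤ lo (x ∷ [])     v = z≤n
slot-≤ lo (x ∷ y ∷ ys) v with lo ≤? x | x ≤? v
... | yes _ | yes _ = s≤s (slot-≤ x (y ∷ ys) v)
... | yes _ | no  _ = z≤n
... | no  _ | _     = z≤n

slot-mono : ∀ {j} lo (c : Vec ℕ (suc j)) {v v′} → v ≤ v′ → slot lo c v ≤ slot lo c v′
slot-mono lo (x ∷ [])     v≤v′ = z≤n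
slot-mono lo (x ∷ y ∷ ys) {v} {v′} v≤v′ with lo ≤? x | x ≤? v | x ≤? v′
... | yes _ | yes _   | yes _    = s≤s (slot-mono x (y ∷ ys) v≤v′)
... | yes _ | yes x≤v | no  x≰v′ = ⊥-elim (x≰v′ (≤-trans x≤v v≤v′))
... | yes _ | no  _   | _        = z≤n
... | no  _ | _       | _        = z≤n

-- The prefix stops at an entry that is either out of order or larger than v, hence not v.
slot-avoids : ∀ {j} lo (c : Vec ℕ (suc j)) {v} → lo ≤ v → (ascending lo c ≡ 1 → v ≢ last c) →
  ∀ i → toℕ i ≡ slot lo c v → lookup c i ≢ v
slot-avoids lo (x ∷ []) lo≤v avoidsLast Fin.zero _ x≡v with lo ≤? x
... | yes _    = avoidsLast refl (sym x≡v)
... | no lo≰x = lo≰x (subst (lo ≤_) (sym x≡v) lo≤v)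
slot-avoids lo (x ∷ y ∷ ys) {v} lo≤v avoidsLast i i≡slot with lo ≤? x | x ≤? v
slot-avoids lo (x ∷ y ∷ ys) lo≤v avoidsLast (Fin.suc i) i≡slot | yes _ | yes x≤v =
  slot-avoids x (y ∷ ys) x≤v avoidsLast i (ℕₚ.suc-injective i≡slot)
slot-avoids lo (x ∷ y ∷ ys) lo≤v avoidsLast Fin.zero i≡slot | yes _ | no x≰v =
  λ x≡v → x≰v (≤-reflexive x≡v)
slot-avoids lo (x ∷ y ∷ ys) lo≤v avoidsLast Fin.zero i≡slot | no lo≰x | _ =
  λ x≡v → lo≰x (subst (lo ≤_) (sym x≡v) lo≤v)

-- Vectors over {0,…,k}

module Grid (k : ℕ) where

  grid : ∀ j → List (Vec ℕ j)
  grid zero    = [ [] ]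
  grid (suc j) = concatMap (λ x → map (x ∷_) (grid j)) (downFrom (suc k))

  ≤k-downFrom : All (_≤ k) (downFrom (suc k))
  ≤k-downFrom = Allₚ.applyDownFrom⁺₁ id (suc k) s≤s⁻¹

  length-grid : ∀ j → length (grid j) ≡ suc k ^ j
  length-grid zero    = refl
  length-grid (suc j) = begin
    length (grid (suc j))                          ≡⟨ length-concatMap-map _∷_ (λ _ → grid j) (downFrom (suc k)) ⟩
    sum (map (λ _ → length (grid j)) (downFrom (suc k))) ≡⟨ sum-map-const _ (downFrom (suc k)) ⟩
    length (downFrom (suc k)) * length (grid j)    ≡⟨ cong₂ _*_ (length-downFrom (suc k)) (length-grid j) ⟩
    suc k ^ suc j                                  ∎
    where open ≡-Reasoning

  grid-unique : ∀ j → Unique (grid j)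
  grid-unique zero    = [] ∷ []
  grid-unique (suc j) = AllPairs-concatMap⁺ _∷_ (λ _ → grid j)
    (λ xs≢ys → xs≢ys ∘ Vecₚ.∷-injectiveʳ) (λ x≢y _ _ → x≢y ∘ Vecₚ.∷-injectiveˡ)
    (Uniqueₚ.downFrom⁺ (suc k)) (λ _ → grid-unique j)

  grid-bounded : ∀ j → All (VecAll.All (_≤ k)) (grid j)
  grid-bounded zero    = VecAll.[] ∷ []
  grid-bounded (suc j) = Allₚ.concat⁺ (Allₚ.map⁺
    (All.map (λ x≤k → Allₚ.map⁺ (All.map (x≤k VecAll.∷_) (grid-bounded j))) ≤k-downFrom))

  ascendingCount : ℕ → ℕ → ℕ
  ascendingCount lo j = sum (map (ascending lo) (grid j))

  private
    startingAt : ℕ → ℕ → ℕ → ℕ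
    startingAt lo j x = sum (map (ascending lo) (map (x ∷_) (grid j)))

    ascendingCount-suc : ∀ lo j →
      ascendingCount lo (suc j) ≡ sum (map (startingAt lo j) (downFrom (suc k)))
    ascendingCount-suc lo j = trans
      (cong sum (map-concatMap (ascending lo) (λ x → map (x ∷_) (grid j)) (downFrom (suc k))))
      (sum-concatMap (λ x → map (ascending lo) (map (x ∷_) (grid j))) (downFrom (suc k)))

    startingAt-≤ : ∀ lo j {x} → lo ≤ x → startingAt lo j x ≡ ascendingCount x j
    startingAt-≤ lo j lo≤x = cong sum (trans (sym (map-∘ (grid j)))
      (map-cong (λ xs → ascending-∷-≤ xs lo≤x) (grid j)))

    startingAt-> : ∀ lo j {x} → x < lo → startingAt lo j x ≡ 0
    startingAt-> lo j {x} x<lo = begin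
      startingAt lo j x              ≡⟨ cong sum (trans (sym (map-∘ (grid j))) (map-cong (λ xs → ascending-∷-> xs x<lo) (grid j))) ⟩
      sum (map (λ _ → 0) (grid j))   ≡⟨ sum-map-const 0 (grid j) ⟩
      length (grid j) * 0            ≡⟨ *-zeroʳ (length (grid j)) ⟩
      0                              ∎
      where open ≡-Reasoning

    startingAt-vanish : ∀ lo j {t} → t ≤ lo → sum (map (startingAt lo j) (downFrom t)) ≡ 0
    startingAt-vanish lo j {zero}  _    = refl
    startingAt-vanish lo j {suc t} t<lo =
      cong₂ _+_ (startingAt-> lo j t<lo) (startingAt-vanish lo j (≤-trans (n≤1+n t) t<lo))

    startingAt-split : ∀ lo j {t} → lo < t →
      sum (map (startingAt lo j) (downFrom t)) ≡
      ascendingCount lo j + sum (map (startingAt (suc lo) j) (downFrom t))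
    startingAt-split lo j {suc t} lo<t with lo ≟ t
    ... | yes refl = begin
      startingAt lo j lo + sum (map (startingAt lo j) (downFrom lo))
        ≡⟨ cong₂ _+_ (startingAt-≤ lo j ≤-refl) (startingAt-vanish lo j ≤-refl) ⟩
      ascendingCount lo j + 0
        ≡⟨ cong (ascendingCount lo j +_) (sym (cong₂ _+_ (startingAt-> (suc lo) j ≤-refl) (startingAt-vanish (suc lo) j (n≤1+n lo)))) ⟩
      ascendingCount lo j + (startingAt (suc lo) j lo + sum (map (startingAt (suc lo) j) (downFrom lo)))
        ∎
      where open ≡-Reasoning
    ... | no lo≢t = begin
      startingAt lo j t + sum (map (startingAt lo j) (downFrom t))
        ≡⟨ cong₂ _+_ (startingAt-≤ lo j lo≤t) (startingAt-split lo j lo<t′) ⟩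
      ascendingCount t j + (ascendingCount lo j + rest)
        ≡⟨ x∙yz≈y∙xz (ascendingCount t j) (ascendingCount lo j) rest ⟩
      ascendingCount lo j + (ascendingCount t j + rest)
        ≡⟨ cong (λ z → ascendingCount lo j + (z + rest)) (sym (startingAt-≤ (suc lo) j lo<t′)) ⟩
      ascendingCount lo j + (startingAt (suc lo) j t + rest)
        ∎
      where
      open ≡-Reasoning
      rest = sum (map (startingAt (suc lo) j) (downFrom t))
      lo≤t = s≤s⁻¹ lo<t
      lo<t′ = ≤∧≢⇒< lo≤t lo≢t

  ascendingCount-step : ∀ {lo} j → lo ≤ k →
    ascendingCount lo (suc j) ≡ ascendingCount lo j + ascendingCount (suc lo) (suc j)
  ascendingCount-step {lo} j lo≤k = begin
    ascendingCount lo (suc j)                                            ≡⟨ ascendingCount-suc lo j ⟩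
    sum (map (startingAt lo j) (downFrom (suc k)))                       ≡⟨ startingAt-split lo j (s≤s lo≤k) ⟩
    ascendingCount lo j + sum (map (startingAt (suc lo) j) (downFrom (suc k))) ≡⟨ cong (ascendingCount lo j +_) (sym (ascendingCount-suc (suc lo) j)) ⟩
    ascendingCount lo j + ascendingCount (suc lo) (suc j)                ∎
    where open ≡-Reasoning

  ascendingCount-beyond : ∀ {lo} j → k < lo → ascendingCount lo (suc j) ≡ 0
  ascendingCount-beyond {lo} j k<lo = trans (ascendingCount-suc lo j) (startingAt-vanish lo j k<lo)

  ascendingCount≡C : ∀ j {lo e} → lo + e ≡ k → ascendingCount lo j ≡ (e + j) C j
  ascendingCount≡C zero    _ = refl
  ascendingCount≡C (suc j) {lo} {zero} lo+0≡k = begin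
    ascendingCount lo (suc j)                             ≡⟨ ascendingCount-step j lo≤k ⟩
    ascendingCount lo j + ascendingCount (suc lo) (suc j) ≡⟨ cong₂ _+_ (ascendingCount≡C j lo+0≡k) (ascendingCount-beyond j (s≤s (≤-reflexive (sym lo≡k)))) ⟩
    j C j + 0                                             ≡⟨ +-identityʳ _ ⟩
    j C j                                                 ≡⟨ trans (nCn≡1 j) (sym (nCn≡1 (suc j))) ⟩
    suc j C suc j                                         ∎
    where
    open ≡-Reasoning
    lo≡k = trans (sym (+-identityʳ lo)) lo+0≡k
    lo≤k = ≤-reflexive lo≡k
  ascendingCount≡C (suc j) {lo} {suc e} lo+1+e≡k = begin
    ascendingCount lo (suc j)                             ≡⟨ ascendingCount-step j lo≤k ⟩
    ascendingCount lo j + ascendingCount (suc lo) (suc j) ≡⟨ cong₂ _+_ (ascendingCount≡C j lo+1+e≡k) (ascendingCount≡C (suc j) 1+lo+e≡k) ⟩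
    (suc e + j) C j + (e + suc j) C suc j                 ≡⟨ cong (λ n → (suc e + j) C j + n C suc j) (+-suc e j) ⟩
    (suc e + j) C j + (suc e + j) C suc j                 ≡⟨ nCk+nC[k+1]≡[n+1]C[k+1] (suc e + j) j ⟩
    suc (suc e + j) C suc j                               ≡⟨ cong (_C suc j) (sym (+-suc (suc e) j)) ⟩
    (suc e + suc j) C suc j                               ∎
    where
    open ≡-Reasoning
    lo≤k = ≤-trans (m≤m+n lo (suc e)) (≤-reflexive lo+1+e≡k)
    1+lo+e≡k = trans (sym (+-suc lo e)) lo+1+e≡k

  Admissible : ∀ {j} → Vec ℕ (suc j) → ℕ → Set
  Admissible c v = v ≤ k × (ascending 0 c ≡ 1 → v ≢ last c)

  allowed : ∀ {j} → Vec ℕ (suc j) → List ℕ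
  allowed c with ascending 0 c ≟ 1
  ... | yes _ = filter (λ v → ¬? (v ≟ last c)) (downFrom (suc k))
  ... | no  _ = downFrom (suc k)

  allowed-admissible : ∀ {j} (c : Vec ℕ (suc j)) → All (Admissible c) (allowed c)
  allowed-admissible c with ascending 0 c ≟ 1
  ... | yes _ = All.zipWith (λ (v≤k , v≢last) → v≤k , λ _ → v≢last)
                  (Allₚ.filter⁺ ≢last? ≤k-downFrom , Allₚ.all-filter ≢last? (downFrom (suc k)))
    where ≢last? = λ v → ¬? (v ≟ last c)
  ... | no ¬ascending = All.map (λ v≤k → v≤k , ⊥-elim ∘ ¬ascending) ≤k-downFrom

  allowed-unique : ∀ {j} (c : Vec ℕ (suc j)) → Unique (allowed c)
  allowed-unique c with ascending 0 c ≟ 1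
  ... | yes _ = Uniqueₚ.filter⁺ (λ v → ¬? (v ≟ last c)) (Uniqueₚ.downFrom⁺ (suc k))
  ... | no  _ = Uniqueₚ.downFrom⁺ (suc k)

  length-allowed : ∀ {j} (c : Vec ℕ (suc j)) → suc k ≤ ascending 0 c + length (allowed c)
  length-allowed c with ascending 0 c ≟ 1
  ... | yes ascending≡1 = begin
    suc k                        ≡⟨ length-downFrom (suc k) ⟨
    length (downFrom (suc k))    ≤⟨ length≤suc-length-filter-≢ _≟_ (last c) (Uniqueₚ.downFrom⁺ (suc k)) ⟩
    1 + length allowed′          ≡⟨ cong (_+ length allowed′) ascending≡1 ⟨
    ascending 0 c + length allowed′ ∎
    where
    open ≤-Reasoning
    allowed′ = filter (λ v → ¬? (v ≟ last c)) (downFrom (suc k))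
  ... | no _ = ≤-trans (≤-reflexive (sym (length-downFrom (suc k)))) (m≤n+m _ _)

  AdmissibleTail : ∀ {j} → Vec ℕ (suc j) × ℕ → Set
  AdmissibleTail (c , v) = VecAll.All (_≤ k) c × Admissible c v

  tailParameters : ∀ j → List (Vec ℕ (suc j) × ℕ)
  tailParameters j = concatMap (λ c → map (c ,_) (allowed c)) (grid (suc j))

  tailParameters-unique : ∀ j → Unique (tailParameters j)
  tailParameters-unique j = AllPairs-concatMap⁺ _,_ allowed
    (λ v≢v′ → v≢v′ ∘ cong proj₂) (λ c≢c′ _ _ → c≢c′ ∘ cong proj₁)
    (grid-unique (suc j)) allowed-unique

  tailParameters-admissible : ∀ j → All AdmissibleTail (tailParameters j)
  tailParameters-admissible j = Allₚ.concat⁺ (Allₚ.map⁺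
    (All.map (λ {c} bounded → Allₚ.map⁺ (All.map (bounded ,_) (allowed-admissible c)))
      (grid-bounded (suc j))))

  length-tailParameters : ∀ j → suc k ^ (2 + j) ∸ (k + suc j) C (suc j) ≤ length (tailParameters j)
  length-tailParameters j = m≤n+o⇒m∸n≤o _ _ (begin
    suc k ^ (2 + j)                    ≡⟨ cong (suc k *_) (length-grid (suc j)) ⟨
    suc k * length cs                  ≡⟨ *-comm (suc k) (length cs) ⟩
    length cs * suc k                  ≤⟨ sum-map-≥ _ length-allowed cs ⟩
    sum (map (λ c → ascending 0 c + length (allowed c)) cs)
                                       ≡⟨ sum-map-+ (ascending 0) (length ∘ allowed) cs ⟩
    ascendingCount 0 (suc j) + sum (map (length ∘ allowed) cs)
                                       ≡⟨ cong₂ _+_ (ascendingCount≡C (suc j) refl) (sym (length-concatMap-map _,_ allowed cs)) ⟩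
    (k + suc j) C (suc j) + length (tailParameters j) ∎)
    where
    open ≤-Reasoning
    cs = grid (suc j)

module _ (d : ℕ) .{{_ : NonZero d}} where

  digits-injective : ∀ {r r′ a b} → r < d → r′ < d → r + a * d ≡ r′ + b * d → r ≡ r′ × a ≡ b
  digits-injective {r} {r′} {a} {b} r<d r′<d eq =
    r≡r′ , *-cancelʳ-≡ a b d (+-cancelˡ-≡ r _ _ (trans eq (cong (_+ b * d) (sym r≡r′))))
    where
    open ≡-Reasoning
    r≡r′ : r ≡ r′
    r≡r′ = begin
      r                 ≡⟨ m<n⇒m%n≡m r<d ⟨
      r % d             ≡⟨ [m+kn]%n≡m%n r a d ⟨
      (r + a * d) % d   ≡⟨ cong (_% d) eq ⟩
      (r′ + b * d) % d  ≡⟨ [m+kn]%n≡m%n r′ b d ⟩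
      r′ % d            ≡⟨ m<n⇒m%n≡m r′<d ⟩
      r′                ∎

  monotone-digits-gap : (f : ℕ → ℕ) → (∀ {x y} → x ≤ y → f x ≤ f y) →
    ∀ {a b} → a < b → d ≤ ∣ f a + a * d - (f b + b * d) ∣
  monotone-digits-gap f f-mono {a} {b} a<b =
    subst (d ≤_) (sym (m≤n⇒∣m-n∣≡n∸m (≤-trans (m≤n+m _ d) gap))) (m+n≤o⇒m≤o∸n d gap)
    where
    gap : d + (f a + a * d) ≤ f b + b * d
    gap = begin
      d + (f a + a * d) ≡⟨ x∙yz≈y∙xz d (f a) (a * d) ⟩
      f a + suc a * d   ≤⟨ +-mono-≤ (f-mono (<⇒≤ a<b)) (*-monoˡ-≤ d a<b) ⟩
      f b + b * d       ∎
      where open ≤-Reasoning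

  monotone-digits-separated : (f : ℕ → ℕ) → (∀ {x y} → x ≤ y → f x ≤ f y) →
    ∀ {a b} → a ≢ b → d ≤ ∣ f a + a * d - (f b + b * d) ∣
  monotone-digits-separated f f-mono {a} {b} a≢b with <-cmp a b
  ... | tri< a<b _ _ = monotone-digits-gap f f-mono a<b
  ... | tri≈ _ a≡b _ = ⊥-elim (a≢b a≡b)
  ... | tri> _ _ b<a = subst (d ≤_) (∣-∣-comm (f b + b * d) (f a + a * d))
                              (monotone-digits-gap f f-mono b<a)

lookup-≢ : ∀ {n} {c c′ : Vec ℕ n} → c ≢ c′ → ∃[ i ] lookup c i ≢ lookup c′ i
lookup-≢ {n} {c} {c′} c≢c′ = ¬∀⟶∃¬ n _ (λ i → lookup c i ≟ lookup c′ i) (λ c≗c′ → c≢c′ (begin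
  c                   ≡⟨ Vecₚ.tabulate∘lookup c ⟨
  tabulate (lookup c)  ≡⟨ Vecₚ.tabulate-cong c≗c′ ⟩
  tabulate (lookup c′) ≡⟨ Vecₚ.tabulate∘lookup c′ ⟩
  c′                  ∎))
  where open ≡-Reasoning

module TailValues (k m : ℕ) where

  open Grid k

  d : ℕ
  d = 2 + m

  tailValue : Vec ℕ (suc m) × ℕ → Fin d → ℕ
  tailValue (c , v) Fin.zero    = slot 0 c v + v * d
  tailValue (c , v) (Fin.suc i) = toℕ i + lookup c i * d

  private
    slot<d : ∀ c v → slot 0 c v < d
    slot<d c v = s≤s (m≤n⇒m≤1+n (slot-≤ 0 c v))

    toℕ<d : ∀ (i : Fin (suc m)) → toℕ i < d
    toℕ<d i = m≤n⇒m≤1+n (toℕ<n i)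

  tailValue-injective : ∀ {p} → AdmissibleTail p → Injective _≡_ _≡_ (tailValue p)
  tailValue-injective                    _                {Fin.zero}  {Fin.zero}   _  = refl
  tailValue-injective {c , v} (_ , _ , avoidsLast) {Fin.zero}  {Fin.suc i}  eq =
    let slot≡i , v≡cᵢ = digits-injective d (slot<d c v) (toℕ<d i) eq
    in ⊥-elim (slot-avoids 0 c z≤n avoidsLast i (sym slot≡i) (sym v≡cᵢ))
  tailValue-injective {c , v} (_ , _ , avoidsLast) {Fin.suc i} {Fin.zero}   eq =
    let i≡slot , cᵢ≡v = digits-injective d (toℕ<d i) (slot<d c v) eq
    in ⊥-elim (slot-avoids 0 c z≤n avoidsLast i i≡slot cᵢ≡v)
  tailValue-injective {c , v} _                         {Fin.suc i} {Fin.suc i′} eq =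
    cong Fin.suc (toℕ-injective (proj₁
      (digits-injective d {a = lookup c i} {lookup c i′} (toℕ<d i) (toℕ<d i′) eq)))

  tailValue-≤ : ∀ {p} → AdmissibleTail p → ∀ j → tailValue p j ≤ m + k * d
  tailValue-≤ {c , v} (_ , v≤k , _) Fin.zero    = +-mono-≤ (slot-≤ 0 c v) (*-monoˡ-≤ d v≤k)
  tailValue-≤ {c , v} (bounded , _) (Fin.suc i) =
    +-mono-≤ (s≤s⁻¹ (toℕ<n i)) (*-monoˡ-≤ d (VecAllₚ.lookup⁺ bounded i))

  tailValue-separated : ∀ {p p′} → p ≢ p′ → ∃[ j ] d ≤ ∣ tailValue p j - tailValue p′ j ∣
  tailValue-separated {c , v} {c′ , v′} p≢p′ with Vecₚ.≡-dec _≟_ c c′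
  ... | yes refl = Fin.zero ,
    monotone-digits-separated d (slot 0 c) (slot-mono 0 c) (p≢p′ ∘ cong (c ,_))
  ... | no c≢c′ with lookup-≢ c≢c′
  ...   | i , cᵢ≢c′ᵢ = Fin.suc i , monotone-digits-separated d (λ _ → toℕ i) (λ _ → ≤-refl) cᵢ≢c′ᵢ

module Extension (k m n : ℕ) (room : (2 + m) * k ≤ suc n) where

  open Grid k
  open TailValues k m

  N : ℕ
  N = d + n

  Tail : Set
  Tail = Σ (Vec ℕ (suc m) × ℕ) AdmissibleTail

  tailValue-< : ∀ {p} → AdmissibleTail p → ∀ j → tailValue p j < N
  tailValue-< admissible j = s≤s (begin
    tailValue _ j   ≤⟨ tailValue-≤ admissible j ⟩
    m + k * d       ≤⟨ +-monoʳ-≤ m (≤-trans (≤-reflexive (*-comm k d)) room) ⟩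
    m + suc n       ≡⟨ +-suc m n ⟩
    suc m + n       ∎)
    where open ≤-Reasoning

  tailMap : Tail → Fin d → Fin N
  tailMap (p , admissible) j = fromℕ< (tailValue-< admissible j)

  tailMap-injective : ∀ t → Injective _≡_ _≡_ (tailMap t)
  tailMap-injective t@(p , admissible) {i} {j} eq = tailValue-injective admissible (begin
    tailValue p i       ≡⟨ toℕ-fromℕ< _ ⟨
    toℕ (tailMap t i)   ≡⟨ cong toℕ eq ⟩
    toℕ (tailMap t j)   ≡⟨ toℕ-fromℕ< _ ⟩
    tailValue p j       ∎)
    where open ≡-Reasoning

  tailMap-cong : ∀ {t t′ : Tail} → proj₁ t ≡ proj₁ t′ → tailMap t ≗ tailMap t′
  tailMap-cong {t} {t′} p≡p′ j = toℕ-injective (begin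
    toℕ (tailMap t j)         ≡⟨ toℕ-fromℕ< _ ⟩
    tailValue (proj₁ t) j     ≡⟨ cong (λ p → tailValue p j) p≡p′ ⟩
    tailValue (proj₁ t′) j    ≡⟨ toℕ-fromℕ< _ ⟨
    toℕ (tailMap t′ j)        ∎)
    where open ≡-Reasoning

  opaque
    extendBy : Permutation′ n → Tail → Permutation′ N
    extendBy σ t = extend (tailMap t) (tailMap-injective t) σ

    toℕ-extendBy-↑ˡ : ∀ σ t j → toℕ (extendBy σ t ⟨$⟩ʳ (j ↑ˡ n)) ≡ tailValue (proj₁ t) j
    toℕ-extendBy-↑ˡ σ t j =
      trans (cong toℕ (extend-↑ˡ (tailMap t) (tailMap-injective t) σ j)) (toℕ-fromℕ< _)

    extendBy-expanding : ∀ σ σ′ {t t′ : Tail} → proj₁ t ≡ proj₁ t′ → ∀ u →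
      ∣ toℕ (σ ⟨$⟩ʳ u) - toℕ (σ′ ⟨$⟩ʳ u) ∣ ≤
      ∣ toℕ (extendBy σ t ⟨$⟩ʳ (d ↑ʳ u)) - toℕ (extendBy σ′ t′ ⟨$⟩ʳ (d ↑ʳ u)) ∣
    extendBy-expanding σ σ′ {t} {t′} p≡p′ u = ≤-trans
      (coreEmbedding-expanding (tailMap t) (tailMap-injective t) (σ ⟨$⟩ʳ u) (σ′ ⟨$⟩ʳ u))
      (≤-reflexive (sym (cong₂ (λ x y → ∣ toℕ x - toℕ y ∣)
        (extend-↑ʳ (tailMap t) (tailMap-injective t) σ u)
        (trans (extend-↑ʳ (tailMap t′) (tailMap-injective t′) σ′ u)
          (coreEmbedding-cong (tailMap-injective t′) (tailMap-injective t)
            (tailMap-cong {t′} {t} (sym p≡p′)) (σ′ ⟨$⟩ʳ u))))))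

  extendBy-separated-tails : ∀ σ σ′ (t t′ : Tail) → proj₁ t ≢ proj₁ t′ →
    d ≤ chebyshev (extendBy σ t) (extendBy σ′ t′)
  extendBy-separated-tails σ σ′ t t′ p≢p′ with tailValue-separated p≢p′
  ... | j , gap = ≤-trans gap (≤-trans
    (≤-reflexive (sym (cong₂ ∣_-_∣ (toℕ-extendBy-↑ˡ σ t j) (toℕ-extendBy-↑ˡ σ′ t′ j))))
    (≤-chebyshev (extendBy σ t) (extendBy σ′ t′) (j ↑ˡ n)))

  extendBy-separated-cores : ∀ {σ σ′} → d ≤ chebyshev σ σ′ → ∀ (t t′ : Tail) → proj₁ t ≡ proj₁ t′ →
    d ≤ chebyshev (extendBy σ t) (extendBy σ′ t′)
  extendBy-separated-cores {σ} {σ′} d≤σσ′ t t′ p≡p′ with chebyshev-witness σ σ′ d≤σσ′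
  ... | u , gap = ≤-trans gap (≤-trans (extendBy-expanding σ σ′ p≡p′ u)
    (≤-chebyshev (extendBy σ t) (extendBy σ′ t′) (d ↑ʳ u)))

  extendBy-separated : ∀ {σ σ′} → d ≤ chebyshev σ σ′ → ∀ (t t′ : Tail) →
    d ≤ chebyshev (extendBy σ t) (extendBy σ′ t′)
  extendBy-separated d≤σσ′ t t′ with Productₚ.≡-dec (Vecₚ.≡-dec _≟_) _≟_ (proj₁ t) (proj₁ t′)
  ... | yes p≡p′ = extendBy-separated-cores d≤σσ′ t t′ p≡p′
  ... | no  p≢p′ = extendBy-separated-tails _ _ t t′ p≢p′

  tails : List Tail
  tails = All.toList (tailParameters-admissible m)

  tails-separated : AllPairs (λ t t′ → proj₁ t ≢ proj₁ t′) tails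
  tails-separated = AllPairsₚ.map⁻
    (subst Unique (sym (map-proj₁-toList (tailParameters-admissible m))) (tailParameters-unique m))

  length-tails : length tails ≡ length (tailParameters m)
  length-tails = trans (sym (length-map proj₁ tails))
    (cong length (map-proj₁-toList (tailParameters-admissible m)))

  extendCode : List (Permutation′ n) → List (Permutation′ N)
  extendCode σs = concatMap (λ σ → map (extendBy σ) tails) σs

  extendCode-isCode : ∀ {σs} → IsCode n d σs → IsCode N d (extendCode σs)
  extendCode-isCode code = AllPairs-concatMap⁺ extendBy (λ _ → tails)
    (extendBy-separated-tails _ _ _ _) extendBy-separated code (λ _ → tails-separated)

  length-extendCode : ∀ σs → length (extendCode σs) ≡ length σs * length tails
  length-extendCode σs = trans (length-concatMap-map extendBy (λ _ → tails) σs) (sum-map-const _ σs)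

  lowerBound : ∀ {p q} → IsP N d p → IsP n d q → (suc k ^ d ∸ (k + suc m) C (suc m)) * q ≤ p
  lowerBound {p} (_ , maximal) ((σs , code , refl) , _) = begin
    (suc k ^ d ∸ (k + suc m) C (suc m)) * length σs ≤⟨ *-monoˡ-≤ (length σs) (length-tailParameters m) ⟩
    length (tailParameters m) * length σs          ≡⟨ cong (_* length σs) length-tails ⟨
    length tails * length σs                       ≡⟨ *-comm (length tails) (length σs) ⟩
    length σs * length tails                       ≡⟨ length-extendCode σs ⟨
    length (extendCode σs)                         ≤⟨ maximal _ (extendCode-isCode code) ⟩
    p                                              ∎
    where open ≤-Reasoning

P-lowerBound : ∀ {d k n p q} → 2 ≤ d → d * k ≤ suc n → IsP (d + n) d p → IsP n d q →
  (suc k ^ d ∸ (k + (d ∸ 1)) C (d ∸ 1)) * q ≤ p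
P-lowerBound {suc (suc m)} {k} {n} (s≤s (s≤s z≤n)) room = Extension.lowerBound k m n room

theorem9 : ∀ (d k p q : ℕ) → d ≥ 3 → k ≥ 1 →
    IsP (d * k + d ∸ 1) d p → IsP (d * k ∸ 1) d q →
    p ≥ ((k + 1) ^ d ∸ ((k + d ∸ 1) C (d ∸ 1))) * q
theorem9 d k p q d≥3 k≥1 hp hq =
  subst₂ (λ a b → (a ^ d ∸ b C (d ∸ 1)) * q ≤ p) (+-comm 1 k) (sym (+-∸-assoc k 1≤d))
    (P-lowerBound (≤-trans (n≤1+n 2) d≥3) (m≤n+m∸n (d * k) 1) (subst (λ N → IsP N d p) N≡d+n hp) hq)
  where
  1≤d : 1 ≤ d
  1≤d = ≤-trans (s≤s z≤n) d≥3
  N≡d+n : d * k + d ∸ 1 ≡ d + (d * k ∸ 1)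
  N≡d+n = trans (+-∸-comm d (*-mono-≤ 1≤d k≥1)) (+-comm (d * k ∸ 1) d)
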